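{- Let $\pi$ be a permutation of $[n]$, $T\ge1$ and $m_1,\dots,m_T\ge1$. There exist pile assignments $\rho_t:[n]\to\{0,\dots,m_t-1\}$ ($t\in[T]$) such that the $T$-round queue shuffle of $\pi$ with $(\rho_1,\dots,\rho_T)$ yields the identity permutation if and only if $\mathrm{ascrun}(\pi)\le\prod_{t=1}^T m_t$.
   Context: A deck of cards labelled by $[n]$ is represented by a permutation $\pi$ of $[n]$ with $\pi(s)$ the position (from the top) of label $s$; the identity is the sorted deck. A single-round queue shuffle with pile assignments $\rho$ (label $s$ goes to pile $\rho(s)$, piles collected in increasing index order, each pile preserving placement order) maps $\pi$ to the unique permutation $\sigma$ of $[n]$ with $\sigma(s)<\sigma(t)$ iff $(\rho(s),\pi(s))<(\rho(t),\pi(t))$ lexicographically. A $T$-round queue shuffle with $(\rho_1,\dots,\rho_T)$ maps $\pi$ to $\pi_T$, where $\pi_0=\pi$ and $\pi_t$ is the single-round queue shuffle of $\pi_{t-1}$ with $\rho_t$; round $t$ has $m_t$ queues. $\mathrm{ascrun}(\pi)$ is the number of ascending runs (maximal contiguous increasing segments) of $(\pi(1),\dots,\pi(n))$. -}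

module Defs where

open import Data.Nat using (ℕ; zero; suc; _+_; _*_; _<_; _<?_; _≟_)
open import Data.Fin using (Fin; toℕ; zero; suc)
open import Data.Fin.Permutation using (Permutation′; _⟨$⟩ʳ_)
open import Data.List using (List; map; length; filter)
open import Data.Nat.ListAction using (product)
open import Data.List using () renaming (allFin to allFinL)
open import Data.Product using (_×_; _,_)
open import Data.Sum using (_⊎_)
open import Relation.Binary.PropositionalEquality using (_≡_)
open import Relation.Nullary using (Dec; yes; no)
open import Relation.Nullary.Decidable using (_⊎-dec_; _×-dec_)

-- A deck state: position (0-indexed, from the top) of each label.
Deck : ℕ → Set
Deck n = Fin n → ℕ

deckOf : ∀ {n} → Permutation′ n → Deck n
deckOf π s = toℕ (π ⟨$⟩ʳ s)

_<lex_ : ℕ × ℕ → ℕ × ℕ → Set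
(a , b) <lex (c , d) = (a < c) ⊎ ((a ≡ c) × (b < d))

_<lex?_ : (p q : ℕ × ℕ) → Dec (p <lex q)
(a , b) <lex? (c , d) = (a <? c) ⊎-dec ((a ≟ c) ×-dec (b <? d))

-- For a permutation π these keys
-- are distinct, so this is exactly the unique permutation σ with
-- σ(s) < σ(t) iff (ρ(s),π(s)) <lex (ρ(t),π(t)).
queueShuffle1 : ∀ {n m} → (Fin n → Fin m) → Deck n → Deck n
queueShuffle1 {n} ρ π s =
  length (filter (λ t → key t <lex? key s) (allFinL n))
  where
  key : Fin _ → ℕ × ℕ
  key u = toℕ (ρ u) , π u

queueShuffle : ∀ {n T} (m : Fin T → ℕ) → ((t : Fin T) → Fin n → Fin (m t)) → Deck n → Deck n
queueShuffle {T = zero} m ρ π = π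
queueShuffle {T = suc T} m ρ π =
  queueShuffle {T = T} (λ t → m (suc t)) (λ t → ρ (suc t)) (queueShuffle1 (ρ zero) π)

IsIdentity : ∀ {n} → Deck n → Set
IsIdentity {n} π = (s : Fin n) → π s ≡ toℕ s

descentsFrom : ℕ → List ℕ → ℕ
descentsFrom x Data.List.[] = 0
descentsFrom x (y Data.List.∷ ys) with y <? x
... | yes _ = suc (descentsFrom y ys)
... | no _ = descentsFrom y ys

ascrunList : List ℕ → ℕ
ascrunList Data.List.[] = 0
ascrunList (x Data.List.∷ xs) = suc (descentsFrom x xs)

ascrun : ∀ {n} → Permutation′ n → ℕ
ascrun {n} π = ascrunList (map (deckOf π) (allFinL n))

prodFin : ∀ {T} → (Fin T → ℕ) → ℕ
prodFin {T} m = product (map m (allFinL T))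

-- After all rounds the cards are ordered by the key (c s , π s), where c s is
-- the mixed-radix number whose digits are the piles of label s (the last round
-- being the most significant digit), exactly as in a least-significant-digit
-- radix sort; c ranges over [0, ∏ m_t) and every such c arises.  Hence the deck
-- ends sorted iff c is weakly increasing along the labels and strictly
-- increasing at each descent of π.  Such a c below ∏ m_t exists iff π has at
-- most ∏ m_t ascending runs: necessity because c rises at least once per
-- descent, sufficiency by taking c s to be the number of descents before s.
{-# OPTIONS --safe #-}
module Submission where

open import Defs
open import Data.Nat using (ℕ; _≤_)
open import Data.Fin using (Fin)
open import Data.Fin.Permutation using (Permutation′)
open import Data.Product using (Σ)
open import Function.Bundles using (_⇔_)

open import Data.Nat using (zero; suc; _+_; _*_; _∸_; _<_; z≤n; s≤s; s≤s⁻¹; z<s; s<s; >-nonZero)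
open import Data.Nat.Properties
open import Data.Nat.DivMod using (_/_; _%_; m≡m%n+[m/n]*n; m%n<n; m<n*o⇒m/o<n)
open import Data.Nat.ListAction using (product)
open import Data.Fin using (toℕ; fromℕ; fromℕ<; zero; suc)
import Data.Fin as Fin
open import Data.Fin.Properties using (toℕ-injective; toℕ<n; toℕ-fromℕ<; toℕ-fromℕ; toℕ≤pred[n])
import Data.Fin.Properties as Finₚ
open import Data.Fin.Permutation using (_⟨$⟩ʳ_)
open import Data.List using ([]; _∷_; filter; length; tabulate; map; allFin)
open import Data.List.Properties using (map-tabulate; length-tabulate; filter-notAll)
open import Data.List.Membership.Propositional using (_∈_; lose)
open import Data.List.Membership.Propositional.Properties using (∈-allFin)
open import Data.List.Relation.Unary.Any using (here; there)
open import Data.Product using (_×_; _,_; proj₁; proj₂; <_,_>)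
import Data.Product as Product
open import Data.Product.Relation.Binary.Lex.Strict using (×-strictTotalOrder)
open import Data.Sum using (_⊎_; inj₁; inj₂)
import Data.Sum as Sum
open import Data.Empty using (⊥-elim)
open import Function using (_∘_)
open import Function.Bundles using (mk⇔; Injection; Equivalence)
open import Function.Definitions using (Injective)
open import Function.Properties.Inverse using (↔⇒↣)
import Function.Properties.Equivalence as ⇔
open import Relation.Binary using (StrictTotalOrder; tri<; tri≈; tri>; _Preserves_⟶_)
open import Relation.Binary.PropositionalEquality
open import Relation.Nullary using (¬_; yes; no)
open import Relation.Unary using (Pred; Decidable; _⊆_)

private
  variable
    n : ℕ

module Lex = StrictTotalOrder (×-strictTotalOrder <-strictTotalOrder <-strictTotalOrder)

LexSorted : (Fin n → ℕ × ℕ) → Set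
LexSorted key = key Preserves Fin._<_ ⟶ _<lex_

LexSorted-≗ : {f g : Fin n → ℕ × ℕ} → f ≗ g → LexSorted f → LexSorted g
LexSorted-≗ f≗g sorted {i} {j} i<j = subst₂ _<lex_ (f≗g i) (f≗g j) (sorted i<j)

LexSorted-∷ : (key : Fin (suc (suc n)) → ℕ × ℕ) →
              key zero <lex key (suc zero) → LexSorted (key ∘ suc) → LexSorted key
LexSorted-∷ key k₀<k₁ sorted {zero}  {suc zero}    _         = k₀<k₁
LexSorted-∷ key k₀<k₁ sorted {zero}  {suc (suc j)} _         = Lex.trans k₀<k₁ (sorted {zero} {suc j} z<s)
LexSorted-∷ key k₀<k₁ sorted {suc i} {suc j}       (s<s i<j) = sorted i<j

LexSorted-+ : ∀ k (c p : Fin n → ℕ) → LexSorted < c , p > → LexSorted < (_+ k) ∘ c , p >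
LexSorted-+ k c p sorted i<j = Sum.map (+-monoˡ-< k) (Product.map₁ (cong (_+ k))) (sorted i<j)

module _ {a p q} {A : Set a} {P : Pred A p} {Q : Pred A q}
         (P? : Decidable P) (Q? : Decidable Q) (P⊆Q : P ⊆ Q) where

  length-filter-mono : ∀ xs → length (filter P? xs) ≤ length (filter Q? xs)
  length-filter-mono [] = z≤n
  length-filter-mono (x ∷ xs) with P? x | Q? x
  ... | yes _  | yes _  = s≤s (length-filter-mono xs)
  ... | yes px | no ¬qx = ⊥-elim (¬qx (P⊆Q px))
  ... | no _   | yes _  = m≤n⇒m≤1+n (length-filter-mono xs)
  ... | no _   | no _   = length-filter-mono xs

  length-filter-strict : ∀ {y} xs → y ∈ xs → Q y → ¬ P y →
                         length (filter P? xs) < length (filter Q? xs)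
  length-filter-strict (x ∷ xs) (here refl) qy ¬py with P? x | Q? x
  ... | yes py | _      = ⊥-elim (¬py py)
  ... | no _   | yes _  = s≤s (length-filter-mono xs)
  ... | no _   | no ¬qy = ⊥-elim (¬qy qy)
  length-filter-strict (x ∷ xs) (there y∈xs) qy ¬py with P? x | Q? x
  ... | yes _  | yes _  = s≤s (length-filter-strict xs y∈xs qy ¬py)
  ... | yes px | no ¬qx = ⊥-elim (¬qx (P⊆Q px))
  ... | no _   | yes _  = m≤n⇒m≤1+n (length-filter-strict xs y∈xs qy ¬py)
  ... | no _   | no _   = length-filter-strict xs y∈xs qy ¬py

module _ {m} (ρ : Fin n → Fin m) (d : Deck n) where

  roundKey : Fin n → ℕ × ℕ
  roundKey s = toℕ (ρ s) , d s

  queueShuffle1-< : ∀ {s t} → roundKey s <lex roundKey t →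
                    queueShuffle1 ρ d s < queueShuffle1 ρ d t
  queueShuffle1-< {s} {t} s<t =
    length-filter-strict (λ u → roundKey u <lex? roundKey s) (λ u → roundKey u <lex? roundKey t)
      (λ u<s → Lex.trans u<s s<t) (allFin n) (∈-allFin s) s<t (Lex.irrefl (refl , refl))

  queueShuffle1-bounded : ∀ s → queueShuffle1 ρ d s < n
  queueShuffle1-bounded s =
    subst (queueShuffle1 ρ d s <_) (length-tabulate {n = n} (λ u → u))
      (filter-notAll (λ u → roundKey u <lex? roundKey s) (allFin n)
        (lose (∈-allFin s) (Lex.irrefl (refl , refl))))

pileCode : ∀ {T} (m : Fin T → ℕ) → ((t : Fin T) → Fin n → Fin (m t)) → Fin n → ℕ
pileCode {T = zero}  m ρ s = 0
pileCode {T = suc T} m ρ s = pileCode (m ∘ suc) (ρ ∘ suc) s * m zero + toℕ (ρ zero s)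

mixedRadix-< : ∀ {a b r r' M} → r < M → a < b → a * M + r < b * M + r'
mixedRadix-< {a} {b} {r} {r'} {M} r<M a<b = begin-strict
  a * M + r  <⟨ +-monoʳ-< (a * M) r<M ⟩
  a * M + M  ≡⟨ +-comm (a * M) M ⟩
  suc a * M  ≤⟨ *-monoˡ-≤ M a<b ⟩
  b * M      ≤⟨ m≤m+n (b * M) r' ⟩
  b * M + r' ∎
  where open ≤-Reasoning

mixedRadix-<lex : ∀ {a b r r' M x y} → r < M → r' < M →
             (a * M + r , x) <lex (b * M + r' , y) →
             a < b ⊎ (a ≡ b × (r , x) <lex (r' , y))
mixedRadix-<lex {a} {b} {M = M} r<M r'<M lex with <-cmp a b
... | tri< a<b _ _ = inj₁ a<b
... | tri≈ _ refl _ = inj₂ (refl , Sum.map (+-cancelˡ-< (a * M) _ _)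
                                           (Product.map₁ (+-cancelˡ-≡ (a * M) _ _)) lex)
... | tri> _ _ b<a = ⊥-elim (<⇒≱ (mixedRadix-< r'<M b<a) (lex⇒≤ lex))
  where
  lex⇒≤ : ∀ {u v x y} → (u , x) <lex (v , y) → u ≤ v
  lex⇒≤ (inj₁ u<v) = <⇒≤ u<v
  lex⇒≤ (inj₂ (refl , _)) = ≤-refl

sortKey : ∀ {T} (m : Fin T → ℕ) → ((t : Fin T) → Fin n → Fin (m t)) → Deck n → Fin n → ℕ × ℕ
sortKey m ρ d = < pileCode m ρ , d >

queueShuffle-< : ∀ T (m : Fin T → ℕ) (ρ : (t : Fin T) → Fin n → Fin (m t)) (d : Deck n) {s t} →
                 sortKey m ρ d s <lex sortKey m ρ d t → queueShuffle m ρ d s < queueShuffle m ρ d t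
queueShuffle-< zero    m ρ d (inj₂ (_ , s<t)) = s<t
queueShuffle-< (suc T) m ρ d s<t =
  queueShuffle-< T (m ∘ suc) (ρ ∘ suc) (queueShuffle1 (ρ zero) d)
    (Sum.map₂ (Product.map₂ (queueShuffle1-< (ρ zero) d))
      (mixedRadix-<lex (toℕ<n (ρ zero _)) (toℕ<n (ρ zero _)) s<t))

queueShuffle-bounded : ∀ T (m : Fin T → ℕ) (ρ : (t : Fin T) → Fin n → Fin (m t)) (d : Deck n) →
                       (∀ s → d s < n) → ∀ s → queueShuffle m ρ d s < n
queueShuffle-bounded zero    m ρ d d<n = d<n
queueShuffle-bounded (suc T) m ρ d _   =
  queueShuffle-bounded T (m ∘ suc) (ρ ∘ suc) (queueShuffle1 (ρ zero) d)
    (queueShuffle1-bounded (ρ zero) d)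

prodFin-suc : ∀ {T} (m : Fin (suc T) → ℕ) → prodFin m ≡ m zero * prodFin (m ∘ suc)
prodFin-suc m = begin
  product (map m (allFin _))             ≡⟨ cong product (map-tabulate (λ t → t) m) ⟩
  m zero * product (tabulate (m ∘ suc))  ≡⟨ cong (λ ms → m zero * product ms)
                                                 (map-tabulate (λ t → t) (m ∘ suc)) ⟨
  m zero * prodFin (m ∘ suc)             ∎
  where open ≡-Reasoning

pileCode-< : ∀ {T} (m : Fin T → ℕ) (ρ : (t : Fin T) → Fin n → Fin (m t)) s →
             pileCode m ρ s < prodFin m
pileCode-< {T = zero}  m ρ s = z<s
pileCode-< {T = suc T} m ρ s = begin-strict
  pileCode (m ∘ suc) (ρ ∘ suc) s * m zero + toℕ (ρ zero s)
    <⟨ mixedRadix-< (toℕ<n (ρ zero s)) (pileCode-< (m ∘ suc) (ρ ∘ suc) s) ⟩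
  prodFin (m ∘ suc) * m zero + 0  ≡⟨ +-identityʳ _ ⟩
  prodFin (m ∘ suc) * m zero      ≡⟨ *-comm (prodFin (m ∘ suc)) (m zero) ⟩
  m zero * prodFin (m ∘ suc)      ≡⟨ prodFin-suc m ⟨
  prodFin m                       ∎
  where open ≤-Reasoning

pileCode-surjective : ∀ {T} (m : Fin T → ℕ) → (∀ t → 1 ≤ m t) →
                      (c : Fin n → ℕ) → (∀ s → c s < prodFin m) →
                      Σ ((t : Fin T) → Fin n → Fin (m t)) (λ ρ → pileCode m ρ ≗ c)
pileCode-surjective {T = zero}  m _ c c<1 = (λ ()) , λ s → sym (n<1⇒n≡0 (c<1 s))
pileCode-surjective {n} {T = suc T} m m≥1 c c<∏ = ρ , ρ-codes-c
  where
  instance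
    m₀≢0 = >-nonZero (m≥1 zero)
  quotients = pileCode-surjective (m ∘ suc) (m≥1 ∘ suc) (λ s → c s / m zero)
    (λ s → m<n*o⇒m/o<n (subst (c s <_) (trans (prodFin-suc m) (*-comm (m zero) _)) (c<∏ s)))
  ρ : (t : Fin (suc T)) → Fin n → Fin (m t)
  ρ zero    s = fromℕ< (m%n<n (c s) (m zero))
  ρ (suc t) = proj₁ quotients t
  ρ-codes-c : pileCode m ρ ≗ c
  ρ-codes-c s = begin
    pileCode (m ∘ suc) (proj₁ quotients) s * m zero + toℕ (ρ zero s)
      ≡⟨ cong₂ (λ q r → q * m zero + r) (proj₂ quotients s) (toℕ-fromℕ< (m%n<n (c s) (m zero))) ⟩
    c s / m zero * m zero + c s % m zero  ≡⟨ +-comm (c s / m zero * m zero) (c s % m zero) ⟩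
    c s % m zero + c s / m zero * m zero  ≡⟨ m≡m%n+[m/n]*n (c s) (m zero) ⟨
    c s                                   ∎
    where open ≡-Reasoning

Increasing : (Fin n → ℕ) → Set
Increasing F = F Preserves Fin._<_ ⟶ _<_

increasing⇒+toℕ≤ : (F : Fin (suc n) → ℕ) → Increasing F → ∀ i → F zero + toℕ i ≤ F i
increasing⇒+toℕ≤ F increasing zero = ≤-reflexive (+-identityʳ (F zero))
increasing⇒+toℕ≤ {suc n} F increasing (suc i) = begin
  F zero + suc (toℕ i)  ≡⟨ +-suc (F zero) (toℕ i) ⟩
  suc (F zero) + toℕ i  ≤⟨ +-monoˡ-≤ (toℕ i) (increasing {zero} {suc zero} z<s) ⟩
  F (suc zero) + toℕ i  ≤⟨ increasing⇒+toℕ≤ (F ∘ suc) (increasing ∘ s<s) i ⟩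
  F (suc i)             ∎
  where open ≤-Reasoning

increasing⇒+∸≤ : (F : Fin (suc n) → ℕ) → Increasing F → ∀ i → F i + (n ∸ toℕ i) ≤ F (fromℕ n)
increasing⇒+∸≤ {n} F increasing zero =
  subst (λ k → F zero + k ≤ F (fromℕ n)) (toℕ-fromℕ n) (increasing⇒+toℕ≤ F increasing (fromℕ n))
increasing⇒+∸≤ {suc n} F increasing (suc i) = increasing⇒+∸≤ (F ∘ suc) (increasing ∘ s<s) i

increasing-bounded⇒IsIdentity : (F : Fin n → ℕ) → (∀ s → F s < n) → Increasing F → IsIdentity F
increasing-bounded⇒IsIdentity {suc n} F F<n increasing s = ≤-antisym F≤s s≤F
  where
  s≤F : toℕ s ≤ F s
  s≤F = ≤-trans (m≤n+m (toℕ s) (F zero)) (increasing⇒+toℕ≤ F increasing s)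
  F≤s : F s ≤ toℕ s
  F≤s = +-cancelʳ-≤ (n ∸ toℕ s) (F s) (toℕ s) (begin
    F s + (n ∸ toℕ s)      ≤⟨ increasing⇒+∸≤ F increasing s ⟩
    F (fromℕ n)            ≤⟨ s≤s⁻¹ (F<n (fromℕ n)) ⟩
    n                      ≡⟨ m+[n∸m]≡n (toℕ≤pred[n] s) ⟨
    toℕ s + (n ∸ toℕ s)    ∎)
    where open ≤-Reasoning

<lex-reflects-< : {key : Fin n → ℕ × ℕ} → Injective _≡_ _≡_ key → (F : Fin n → ℕ) →
                  (∀ {s t} → key s <lex key t → F s < F t) →
                  ∀ {s t} → F s < F t → key s <lex key t
<lex-reflects-< {key = key} injective F monotone {s} {t} Fs<Ft with Lex.compare (key s) (key t)
... | tri< s<t _ _       = s<t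
... | tri≈ _ (e₁ , e₂) _ = ⊥-elim (<-irrefl (cong F (injective (cong₂ _,_ e₁ e₂))) Fs<Ft)
... | tri> _ _ t<s       = ⊥-elim (<-asym Fs<Ft (monotone t<s))

IsIdentity-queueShuffle⇔LexSorted :
  ∀ T (m : Fin T → ℕ) (ρ : (t : Fin T) → Fin n → Fin (m t)) (d : Deck n) →
  Injective _≡_ _≡_ d → (∀ s → d s < n) →
  IsIdentity (queueShuffle m ρ d) ⇔ LexSorted (sortKey m ρ d)
IsIdentity-queueShuffle⇔LexSorted T m ρ d d-injective d<n = mk⇔ sorted⇒lexSorted lexSorted⇒sorted
  where
  shuffled = queueShuffle m ρ d
  sorted⇒lexSorted : IsIdentity shuffled → LexSorted (sortKey m ρ d)
  sorted⇒lexSorted identity {i} {j} i<j =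
    <lex-reflects-< (d-injective ∘ cong proj₂) shuffled (queueShuffle-< T m ρ d)
      (subst₂ _<_ (sym (identity i)) (sym (identity j)) i<j)
  lexSorted⇒sorted : LexSorted (sortKey m ρ d) → IsIdentity shuffled
  lexSorted⇒sorted lexSorted = increasing-bounded⇒IsIdentity shuffled
    (queueShuffle-bounded T m ρ d d<n) (queueShuffle-< T m ρ d ∘ lexSorted)

Sortable : ∀ {T} → (Fin T → ℕ) → Deck n → Set
Sortable {n} {T} m d = Σ ((t : Fin T) → Fin n → Fin (m t)) (λ ρ → IsIdentity (queueShuffle m ρ d))

LexColourable : ℕ → (Fin n → ℕ) → Set
LexColourable B p = Σ (Fin _ → ℕ) λ c → (∀ i → c i < B) × LexSorted < c , p >

sortable⇔LexColourable :
  ∀ T (m : Fin T → ℕ) → (∀ t → 1 ≤ m t) → (d : Deck n) → Injective _≡_ _≡_ d → (∀ s → d s < n) →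
  Sortable m d ⇔ LexColourable (prodFin m) d
sortable⇔LexColourable T m m≥1 d d-injective d<n = mk⇔ sortable⇒colourable colourable⇒sortable
  where
  sorted⇔ : ∀ ρ → IsIdentity (queueShuffle m ρ d) ⇔ LexSorted (sortKey m ρ d)
  sorted⇔ ρ = IsIdentity-queueShuffle⇔LexSorted T m ρ d d-injective d<n
  sortable⇒colourable : Sortable m d → LexColourable (prodFin m) d
  sortable⇒colourable (ρ , sorted) = pileCode m ρ , pileCode-< m ρ , Equivalence.to (sorted⇔ ρ) sorted
  colourable⇒sortable : LexColourable (prodFin m) d → Sortable m d
  colourable⇒sortable (c , c<∏ , lexSorted) with pileCode-surjective m m≥1 c c<∏
  ... | ρ , ρ≗c =
    ρ , Equivalence.from (sorted⇔ ρ) (LexSorted-≗ (λ s → cong (_, d s) (sym (ρ≗c s))) lexSorted)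

descentInd : ℕ → ℕ → ℕ
descentInd x y with y <? x
... | yes _ = 1
... | no _  = 0

descentsFrom-∷ : ∀ x y ys → descentsFrom x (y ∷ ys) ≡ descentInd x y + descentsFrom y ys
descentsFrom-∷ x y ys with y <? x
... | yes _ = refl
... | no _  = refl

<lex⇒+descentInd≤ : ∀ {a b x y} → (a , x) <lex (b , y) → a + descentInd x y ≤ b
<lex⇒+descentInd≤ {a} {b} {x} {y} a,x<b,y with y <? x | a,x<b,y
... | yes _   | inj₁ a<b         = subst (_≤ b) (+-comm 1 a) a<b
... | yes y<x | inj₂ (refl , x<y) = ⊥-elim (<-asym x<y y<x)
... | no _    | inj₁ a<b         = subst (_≤ b) (sym (+-identityʳ a)) (<⇒≤ a<b)
... | no _    | inj₂ (refl , _)   = ≤-reflexive (+-identityʳ a)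

≢⇒<lex-+descentInd : ∀ {a x y} → x ≢ y → (a , x) <lex (a + descentInd x y , y)
≢⇒<lex-+descentInd {a} {x} {y} x≢y with y <? x
... | yes _  = inj₁ (m<m+n a z<s)
... | no y≮x = inj₂ (sym (+-identityʳ a) , ≤∧≢⇒< (≮⇒≥ y≮x) x≢y)

descents : (Fin (suc n) → ℕ) → ℕ
descents p = descentsFrom (p zero) (tabulate (p ∘ suc))

descents-suc : (p : Fin (suc (suc n)) → ℕ) →
               descents p ≡ descentInd (p zero) (p (suc zero)) + descents (p ∘ suc)
descents-suc p = descentsFrom-∷ (p zero) (p (suc zero)) _

descentsBefore : (Fin (suc n) → ℕ) → Fin (suc n) → ℕ
descentsBefore p zero = 0
descentsBefore {suc n} p (suc i) = descentsBefore (p ∘ suc) i + descentInd (p zero) (p (suc zero))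

descentsBefore≤descents : (p : Fin (suc n) → ℕ) → ∀ i → descentsBefore p i ≤ descents p
descentsBefore≤descents p zero = z≤n
descentsBefore≤descents {suc n} p (suc i) = begin
  descentsBefore (p ∘ suc) i + δ  ≤⟨ +-monoˡ-≤ δ (descentsBefore≤descents (p ∘ suc) i) ⟩
  descents (p ∘ suc) + δ          ≡⟨ +-comm (descents (p ∘ suc)) δ ⟩
  δ + descents (p ∘ suc)          ≡⟨ descents-suc p ⟨
  descents p                      ∎
  where
  open ≤-Reasoning
  δ = descentInd (p zero) (p (suc zero))

descentsBefore-lexSorted : (p : Fin (suc n) → ℕ) → Injective _≡_ _≡_ p →
                           LexSorted < descentsBefore p , p >
descentsBefore-lexSorted {zero}  p _ {zero} {zero} ()
descentsBefore-lexSorted {suc n} p p-injective =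
  LexSorted-∷ < descentsBefore p , p >
    (≢⇒<lex-+descentInd (λ p₀≡p₁ → Finₚ.0≢1+n (p-injective p₀≡p₁)))
    (LexSorted-+ _ (descentsBefore (p ∘ suc)) (p ∘ suc)
      (descentsBefore-lexSorted (p ∘ suc) (Finₚ.suc-injective ∘ p-injective)))

LexSorted⇒+descents≤ : (c p : Fin (suc n) → ℕ) → LexSorted < c , p > →
                       c zero + descents p ≤ c (fromℕ n)
LexSorted⇒+descents≤ {zero}  c p sorted = ≤-reflexive (+-identityʳ (c zero))
LexSorted⇒+descents≤ {suc n} c p sorted = begin
  c zero + descents p                    ≡⟨ cong (c zero +_) (descents-suc p) ⟩
  c zero + (δ + descents (p ∘ suc))      ≡⟨ +-assoc (c zero) δ _ ⟨
  c zero + δ + descents (p ∘ suc)        ≤⟨ +-monoˡ-≤ _ (<lex⇒+descentInd≤ (sorted {zero} {suc zero} z<s)) ⟩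
  c (suc zero) + descents (p ∘ suc)      ≤⟨ LexSorted⇒+descents≤ (c ∘ suc) (p ∘ suc) (sorted ∘ s<s) ⟩
  c (fromℕ (suc n))                      ∎
  where
  open ≤-Reasoning
  δ = descentInd (p zero) (p (suc zero))

LexColourable⇔ascrunList≤ : (p : Fin n → ℕ) → Injective _≡_ _≡_ p → ∀ B →
                            LexColourable B p ⇔ ascrunList (tabulate p) ≤ B
LexColourable⇔ascrunList≤ {zero}  p _ B = mk⇔ (λ _ → z≤n) (λ _ → (λ ()) , (λ ()) , λ { {()} })
LexColourable⇔ascrunList≤ {suc n} p p-injective B = mk⇔ colourable⇒runs≤ runs≤⇒colourable
  where
  colourable⇒runs≤ : LexColourable B p → suc (descents p) ≤ B
  colourable⇒runs≤ (c , c<B , sorted) =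
    ≤-trans (s≤s (≤-trans (m≤n+m (descents p) (c zero)) (LexSorted⇒+descents≤ c p sorted)))
            (c<B (fromℕ n))
  runs≤⇒colourable : suc (descents p) ≤ B → LexColourable B p
  runs≤⇒colourable runs≤B =
    descentsBefore p , (λ i → <-≤-trans (s≤s (descentsBefore≤descents p i)) runs≤B) ,
    descentsBefore-lexSorted p p-injective

deckOf-injective : (π : Permutation′ n) → Injective _≡_ _≡_ (deckOf π)
deckOf-injective π = Injection.injective (↔⇒↣ π) ∘ toℕ-injective

ascrun≡ascrunList-tabulate : (π : Permutation′ n) → ascrun π ≡ ascrunList (tabulate (deckOf π))
ascrun≡ascrunList-tabulate π = cong ascrunList (map-tabulate (λ s → s) (deckOf π))

lemma11 : (n : ℕ) (π : Permutation′ n) (T : ℕ) → 1 ≤ T →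
    (m : Fin T → ℕ) → ((t : Fin T) → 1 ≤ m t) →
    (Σ ((t : Fin T) → Fin n → Fin (m t))
       (λ ρ → IsIdentity (queueShuffle m ρ (deckOf π))))
    ⇔ (ascrun π ≤ prodFin m)
lemma11 n π T _ m m≥1 =
  subst (λ runs → Sortable m p ⇔ runs ≤ prodFin m) (sym (ascrun≡ascrunList-tabulate π))
    (⇔.trans (sortable⇔LexColourable T m m≥1 p (deckOf-injective π) (λ s → toℕ<n (π ⟨$⟩ʳ s)))
             (LexColourable⇔ascrunList≤ p (deckOf-injective π) (prodFin m)))
  where
  p = deckOf π
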